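{- Let $x$ be a sequence of pairwise distinct integers of length $m$, $i\in\{1,\ldots,m-1\}$ and $y=\tau(x,i)$. Then $SN_y[j]=SN_x[j]$ for every position $j\le m$ such that $j\notin\{i,\ i+1,\ \mathrm{ref}_x(i),\ \mathrm{ref}_x(i+1),\ \mathrm{ref}_y(i),\ \mathrm{ref}_y(i+1)\}$.
   Context: $\tau(x,i)$ exchanges $x[i]$ and $x[i+1]$. The Cartesian tree $C(x)$ of $x[1\ldots m]$ has as root the node labeled by the position $g$ of the minimum of $x$, left subtree $C(x[1\ldots g-1])$ and right subtree the Cartesian tree of $x[g+1\ldots m]$ (nodes labeled by positions). $C_h(x)$ is the subtree rooted at node $h$. The Skipped-number representation is $SN_x[h]=$ the number of nodes on the right branch (root and successive right children) of the left subtree of $C_h(x)$ ($0$ if that subtree is empty). The referent $\mathrm{ref}_x(h)$ is the smallest position $j>h$ with $x[j]<x[h]$, and $-1$ if no such position exists. -}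

module Defs where

open import Data.Nat as ℕ using (ℕ; zero; suc; _+_)
open import Data.Integer as ℤ using (ℤ; +_; -1ℤ)
open import Data.Integer.Properties using (_<?_)
open import Data.List using (List; []; _∷_; take; drop)
open import Data.Maybe using (Maybe; just; nothing)
open import Data.Product using (_×_; _,_)
open import Relation.Nullary using (yes; no)

-- Sequences x[1..m] are lists of integers; positions are 1-indexed naturals.

at : List ℤ → ℕ → Maybe ℤ
at []       _             = nothing
at (a ∷ xs) zero          = nothing
at (a ∷ xs) (suc zero)    = just a
at (a ∷ xs) (suc (suc h)) = at xs (suc h)

τ : List ℤ → ℕ → List ℤ
τ (a ∷ b ∷ xs) (suc zero)    = b ∷ a ∷ xs
τ (a ∷ xs)     (suc (suc i)) = a ∷ τ xs (suc i)
τ xs           _             = xs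

-- minimum of (a ∷ xs) together with its 0-based index (first occurrence)
minIx : ℤ → List ℤ → ℤ × ℕ
minIx a [] = a , 0
minIx a (b ∷ xs) with minIx b xs
... | v , k with v <? a
...   | yes _ = v , suc k
...   | no  _ = a , 0

data Tree : Set where
  leaf : Tree
  node : Tree → ℕ → Tree → Tree

-- Cartesian tree of a segment whose first element sits at position off+1;
-- the fuel argument is the length of the segment (always sufficient).
cartAux : ℕ → ℕ → List ℤ → Tree
cartAux zero    off xs       = leaf
cartAux (suc f) off []       = leaf
cartAux (suc f) off (a ∷ xs) with minIx a xs
... | _ , g = node (cartAux f off (take g (a ∷ xs)))
                   (off + suc g)
                   (cartAux f (off + suc g) (drop (suc g) (a ∷ xs)))

C : List ℤ → Tree
C xs = cartAux (Data.List.length xs) 0 xs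

subtree : ℕ → Tree → Maybe Tree
subtree h leaf = nothing
subtree h (node l k r) with h ℕ.≟ k
... | yes _ = just (node l k r)
... | no  _ with subtree h l
...   | just t  = just t
...   | nothing = subtree h r

rightBranch : Tree → ℕ
rightBranch leaf         = 0
rightBranch (node _ _ r) = suc (rightBranch r)

SN : List ℤ → ℕ → ℕ
SN xs h with subtree h (C xs)
... | just (node l _ _) = rightBranch l
... | just leaf         = 0
... | nothing           = 0

-- first position (≥ pos) in ys with value < v, where ys starts at position pos
refSearch : ℤ → ℕ → List ℤ → ℤ
refSearch v pos []       = -1ℤ
refSearch v pos (b ∷ ys) with b <? v
... | yes _ = + pos
... | no  _ = refSearch v (suc pos) ys

ref : List ℤ → ℕ → ℤ
ref xs h with at xs h
... | just v  = refSearch v (suc h) (drop h xs)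
... | nothing = -1ℤ

{-# OPTIONS --safe #-}
module Submission where

-- SN_x[t] counts the positions whose referent is t: the left subtree of node t
-- is the Cartesian tree of the segment between t and the nearest smaller entry
-- to its left, and its right branch consists of the suffix minima of that
-- segment, which are exactly those positions.  Exchanging x[i] and x[i+1] can
-- only move the referent of a position h ∉ {i, i+1} between i and i+1, so the
-- count at any other j changes only through the referents of i and i+1, taken
-- before or after the exchange.

open import Defs
open import Data.Nat as ℕ using (ℕ; zero; suc; _+_; _≤_; _<_; z≤n; s≤s; s≤s⁻¹)
import Data.Nat.Properties as ℕₚ
open import Data.Integer as ℤ using (ℤ; +_)
open import Data.Integer.Properties as ℤₚ using (_<?_)
open import Data.List using (List; []; _∷_; _++_; length; take; drop)
open import Data.List.Properties using (length-++; length-++-sucʳ)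
open import Data.List.Relation.Unary.All as All using (All; []; _∷_)
open import Data.List.Relation.Unary.All.Properties using (++⁺)
open import Data.List.Relation.Unary.AllPairs using (AllPairs)
open import Data.Maybe as Maybe using (Maybe; just; nothing)
import Data.Maybe.Properties as Maybeₚ
open import Data.Product using (_×_; _,_; proj₁; proj₂; ∃-syntax)
open import Function using (_∘_)
open import Relation.Binary.Definitions using (DecidableEquality; tri<; tri≈; tri>)
open import Relation.Binary.PropositionalEquality
  using (_≡_; _≢_; refl; sym; trans; cong; cong₂; subst; subst₂; module ≡-Reasoning)
open import Relation.Nullary using (¬_; Dec; yes; no; contradiction)

indicator : {P : Set} → Dec P → ℕ
indicator (yes _) = 1
indicator (no _)  = 0

indicator-yes : {P : Set} → P → (p? : Dec P) → indicator p? ≡ 1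
indicator-yes p (yes _) = refl
indicator-yes p (no ¬p) = contradiction p ¬p

indicator-no : {P : Set} → ¬ P → (p? : Dec P) → indicator p? ≡ 0
indicator-no ¬p (yes p) = contradiction p ¬p
indicator-no ¬p (no _)  = refl

indicator-cong : {P Q : Set} → (P → Q) → (Q → P) →
                 (p? : Dec P) (q? : Dec Q) → indicator p? ≡ indicator q?
indicator-cong P→Q Q→P (yes p) q? = sym (indicator-yes (P→Q p) q?)
indicator-cong P→Q Q→P (no ¬p) q? = sym (indicator-no (¬p ∘ Q→P) q?)

_≟_ : DecidableEquality (Maybe ℕ)
_≟_ = Maybeₚ.≡-dec ℕ._≟_

-- The offset, counted from 1, of the first entry of ys below v: if x[h] = v and
-- ys = x[h+1 …], this is ref_x(h) - h.
nextSmaller : ℤ → List ℤ → Maybe ℕ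
nextSmaller v []       = nothing
nextSmaller v (b ∷ ys) with b <? v
... | yes _ = just 1
... | no  _ = Maybe.map suc (nextSmaller v ys)

-- The number of positions of xs whose referent is t.
referrers : List ℤ → ℕ → ℕ
referrers []       _       = 0
referrers (a ∷ xs) zero    = 0
referrers (a ∷ xs) (suc t) = indicator (nextSmaller a xs ≟ just t) + referrers xs t

suffixMinima : List ℤ → ℕ
suffixMinima []       = 0
suffixMinima (a ∷ xs) = indicator (nextSmaller a xs ≟ nothing) + suffixMinima xs

referrers-zero : ∀ xs → referrers xs 0 ≡ 0
referrers-zero []      = refl
referrers-zero (_ ∷ _) = refl

nextSmaller-≢0 : ∀ v ys → nextSmaller v ys ≢ just 0
nextSmaller-≢0 v [] ()
nextSmaller-≢0 v (b ∷ ys) with b <? v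
... | yes _ = λ ()
... | no  _ with nextSmaller v ys
...   | nothing = λ ()
...   | just _  = λ ()

nextSmaller-≤length : ∀ v ys {d} → nextSmaller v ys ≡ just d → d ≤ length ys
nextSmaller-≤length v [] ()
nextSmaller-≤length v (b ∷ ys) e with b <? v
nextSmaller-≤length v (b ∷ ys) refl | yes _ = s≤s z≤n
... | no _ with nextSmaller v ys | nextSmaller-≤length v ys
nextSmaller-≤length v (b ∷ ys) refl | no _ | just d | ih = s≤s (ih refl)

nextSmaller-++ : ∀ v A R {d} → nextSmaller v A ≡ just d → nextSmaller v (A ++ R) ≡ just d
nextSmaller-++ v [] R ()
nextSmaller-++ v (b ∷ A) R e with b <? v
... | yes _ = e
... | no _ with nextSmaller v A | nextSmaller-++ v A R
nextSmaller-++ v (b ∷ A) R refl | no _ | just d | ih rewrite ih refl = refl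

nextSmaller-++⁻ : ∀ v A R {d} → nextSmaller v (A ++ R) ≡ just d → d ≤ length A →
                  nextSmaller v A ≡ just d
nextSmaller-++⁻ v [] R e z≤n = contradiction e (nextSmaller-≢0 v R)
nextSmaller-++⁻ v (b ∷ A) R e d≤ with b <? v
... | yes _ = e
... | no _ with nextSmaller v (A ++ R) | nextSmaller-++⁻ v A R
nextSmaller-++⁻ v (b ∷ A) R refl (s≤s d≤) | no _ | just d | ih rewrite ih refl d≤ = refl

nextSmaller-none : ∀ v B → All (v ℤ.≤_) B → nextSmaller v B ≡ nothing
nextSmaller-none v [] [] = refl
nextSmaller-none v (b ∷ B) (v≤b ∷ v≤B) with b <? v
... | yes b<v = contradiction b<v (ℤₚ.≤⇒≯ v≤b)
... | no _ rewrite nextSmaller-none v B v≤B = refl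

nextSmaller-first : ∀ a v A B → v ℤ.< a → nextSmaller a A ≡ nothing →
                    nextSmaller a (A ++ v ∷ B) ≡ just (suc (length A))
nextSmaller-first a v [] B v<a _ with v <? a
... | yes _   = refl
... | no v≮a = contradiction v<a v≮a
nextSmaller-first a v (b ∷ A) B v<a e with b <? a
nextSmaller-first a v (b ∷ A) B v<a () | yes _
... | no _ with nextSmaller a A | nextSmaller-first a v A B v<a
...   | nothing | ih rewrite ih refl = refl

nextSmaller-before : ∀ a v A B → v ℤ.< a →
                     ∃[ d ] nextSmaller a (A ++ v ∷ B) ≡ just d × d ≤ suc (length A)
nextSmaller-before a v A B v<a with nextSmaller a A in e
... | nothing = suc (length A) , nextSmaller-first a v A B v<a e , ℕₚ.≤-refl
... | just d  = d , nextSmaller-++ a A (v ∷ B) e , ℕₚ.m≤n⇒m≤1+n (nextSmaller-≤length a A e)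

referrers-++ : ∀ A R t → t ≤ length A → referrers (A ++ R) t ≡ referrers A t
referrers-++ []      R zero    z≤n      = referrers-zero R
referrers-++ (a ∷ A) R zero    _        = refl
referrers-++ (a ∷ A) R (suc t) (s≤s t≤) =
  cong₂ _+_ (indicator-cong (λ e → nextSmaller-++⁻ a A R e t≤) (nextSmaller-++ a A R) _ _)
            (referrers-++ A R t t≤)

referrers-at-min : ∀ v A B → All (v ℤ.<_) A →
                   referrers (A ++ v ∷ B) (suc (length A)) ≡ suffixMinima A
referrers-at-min v []      B []          =
  cong₂ _+_ (indicator-no (nextSmaller-≢0 v B) _) (referrers-zero B)
referrers-at-min v (a ∷ A) B (v<a ∷ v<A) = cong₂ _+_ hitsMin (referrers-at-min v A B v<A)
  where
  hitsMin : indicator (nextSmaller a (A ++ v ∷ B) ≟ just (suc (length A)))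
          ≡ indicator (nextSmaller a A ≟ nothing)
  hitsMin with nextSmaller a A in e
  ... | nothing = indicator-yes (nextSmaller-first a v A B v<a e) _
  ... | just d  = indicator-no (λ e′ → ℕₚ.<⇒≢ (s≤s (nextSmaller-≤length a A e))
                    (Maybeₚ.just-injective (trans (sym (nextSmaller-++ a A (v ∷ B) e)) e′))) _

referrers-after-min : ∀ v A B u → All (v ℤ.<_) A → All (v ℤ.≤_) B →
                      referrers (A ++ v ∷ B) (suc (suc (length A)) + u) ≡ referrers B (suc u)
referrers-after-min v []      B u []          v≤B rewrite nextSmaller-none v B v≤B = refl
referrers-after-min v (a ∷ A) B u (v<a ∷ v<A) v≤B with nextSmaller-before a v A B v<a
... | d , e , d≤ = cong₂ _+_ (indicator-no hitsLater _) (referrers-after-min v A B u v<A v≤B)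
  where
  hitsLater : nextSmaller a (A ++ v ∷ B) ≢ just (suc (suc (length A)) + u)
  hitsLater e′ = ℕₚ.<⇒≢ (s≤s (ℕₚ.≤-trans d≤ (ℕₚ.m≤m+n (suc (length A)) u)))
                         (Maybeₚ.just-injective (trans (sym e) e′))

suffixMinima-at-min : ∀ v A B → All (v ℤ.<_) A → All (v ℤ.≤_) B →
                      suffixMinima (A ++ v ∷ B) ≡ suc (suffixMinima B)
suffixMinima-at-min v []      B []          v≤B rewrite nextSmaller-none v B v≤B = refl
suffixMinima-at-min v (a ∷ A) B (v<a ∷ v<A) v≤B with nextSmaller-before a v A B v<a
... | _ , e , _ rewrite e = suffixMinima-at-min v A B v<A v≤B

record MinSplit (xs : List ℤ) (vg : ℤ × ℕ) : Set where
  constructor minSplit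
  field
    before after  : List ℤ
    xs≡           : xs ≡ before ++ proj₁ vg ∷ after
    length-before : length before ≡ proj₂ vg
    min<before    : All (proj₁ vg ℤ.<_) before
    min≤after     : All (proj₁ vg ℤ.≤_) after

minIx-split : ∀ a xs → MinSplit (a ∷ xs) (minIx a xs)
minIx-split a []       = minSplit [] [] refl refl [] []
minIx-split a (b ∷ xs) with minIx b xs | minIx-split b xs
... | v , k | minSplit A B xs≡ refl v<A v≤B with v <? a
...   | yes v<a = minSplit (a ∷ A) B (cong (a ∷_) xs≡) refl (v<a ∷ v<A) v≤B
...   | no v≮a  = minSplit [] (b ∷ xs) refl refl []
                    (subst (All (a ℤ.≤_)) (sym xs≡)
                      (++⁺ (All.map (ℤₚ.<⇒≤ ∘ ℤₚ.≤-<-trans a≤v) v<A)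
                           (a≤v ∷ All.map (ℤₚ.≤-trans a≤v) v≤B)))
  where a≤v = ℤₚ.≮⇒≥ v≮a

take-length-++ : ∀ {X : Set} (xs ys : List X) → take (length xs) (xs ++ ys) ≡ xs
take-length-++ []       ys = refl
take-length-++ (x ∷ xs) ys = cong (x ∷_) (take-length-++ xs ys)

drop-suc-length-++ : ∀ {X : Set} (xs : List X) y ys → drop (suc (length xs)) (xs ++ y ∷ ys) ≡ ys
drop-suc-length-++ []       y ys = refl
drop-suc-length-++ (x ∷ xs) y ys = drop-suc-length-++ xs y ys

length-split : ∀ {X : Set} (A : List X) v B → length (A ++ v ∷ B) ≡ suc (length A) + length B
length-split A v B = trans (length-++-sucʳ A v B) (cong suc (length-++ A))

cartNode : ℕ → ℕ → List ℤ → List ℤ → Tree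
cartNode f off A B = node (cartAux f off A) (off + suc (length A)) (cartAux f (off + suc (length A)) B)

record RootSplit (f off : ℕ) (s : List ℤ) : Set where
  constructor rootSplit
  field
    A     : List ℤ
    v     : ℤ
    B     : List ℤ
    s≡    : s ≡ A ++ v ∷ B
    v<A   : All (v ℤ.<_) A
    v≤B   : All (v ℤ.≤_) B
    tree≡ : cartAux (suc f) off s ≡ cartNode f off A B

cartAux-split : ∀ f off a xs → RootSplit f off (a ∷ xs)
cartAux-split f off a xs with minIx-split a xs
... | minSplit A B s≡ len≡ v<A v≤B = rootSplit A _ B s≡ v<A v≤B (splitAt s≡ len≡)
  where
  splitAt : ∀ {s v g} → s ≡ A ++ v ∷ B → length A ≡ g →
            node (cartAux f off (take g s)) (off + suc g) (cartAux f (off + suc g) (drop (suc g) s))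
          ≡ cartNode f off A B
  splitAt {v = v} refl refl =
    cong₂ (λ L R → node (cartAux f off L) (off + suc (length A)) (cartAux f (off + suc (length A)) R))
          (take-length-++ A (v ∷ B)) (drop-suc-length-++ A v B)

parts-fuel : ∀ {f} {s A : List ℤ} {v B} → s ≡ A ++ v ∷ B → length s ≤ suc f →
             length A ≤ f × length B ≤ f
parts-fuel {A = A} {v} {B} refl len≤ with s≤s⁻¹ (subst (_≤ _) (length-split A v B) len≤)
... | le = ℕₚ.m+n≤o⇒m≤o (length A) le , ℕₚ.m+n≤o⇒n≤o (length A) le

rightBranch-cartAux : ∀ f off s → length s ≤ f → rightBranch (cartAux f off s) ≡ suffixMinima s
rightBranch-cartAux zero    off []       _     = refl
rightBranch-cartAux (suc f) off []       _     = refl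
rightBranch-cartAux (suc f) off (a ∷ xs) len≤ with cartAux-split f off a xs
... | rootSplit A v B s≡ v<A v≤B tree≡ = begin
  rightBranch (cartAux (suc f) off (a ∷ xs))              ≡⟨ cong rightBranch tree≡ ⟩
  suc (rightBranch (cartAux f (off + suc (length A)) B))  ≡⟨ cong suc (rightBranch-cartAux f _ B lenB≤) ⟩
  suc (suffixMinima B)                                    ≡⟨ suffixMinima-at-min v A B v<A v≤B ⟨
  suffixMinima (A ++ v ∷ B)                               ≡⟨ cong suffixMinima s≡ ⟨
  suffixMinima (a ∷ xs)                                   ∎
  where
  open ≡-Reasoning
  lenB≤ = proj₂ (parts-fuel s≡ len≤)

data _hasSN_ : Maybe Tree → ℕ → Set where
  at-node : ∀ {l k r n} → rightBranch l ≡ n → just (node l k r) hasSN n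

SN-hasSN : ∀ x j {n} → subtree j (C x) hasSN n → SN x j ≡ n
SN-hasSN x j p with subtree j (C x) | p
... | just (node l k r) | at-node e = e

subtree-root : ∀ l k r → subtree k (node l k r) ≡ just (node l k r)
subtree-root l k r with k ℕ.≟ k
... | yes _   = refl
... | no k≢k = contradiction refl k≢k

subtree-left : ∀ {h l k r n} → h ≢ k → subtree h l hasSN n → subtree h (node l k r) hasSN n
subtree-left {h} {l} {k} h≢k p with h ℕ.≟ k
... | yes h≡k = contradiction h≡k h≢k
... | no _ with subtree h l | p
...   | just _ | q = q

subtree-right : ∀ {h l k r} → h ≢ k → subtree h l ≡ nothing →
                subtree h (node l k r) ≡ subtree h r
subtree-right {h} {l} {k} h≢k e with h ℕ.≟ k
... | yes h≡k = contradiction h≡k h≢k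
... | no _ rewrite e = refl

subtree-cartAux-beyond : ∀ f off s h → off + length s < h → subtree h (cartAux f off s) ≡ nothing
subtree-cartAux-beyond zero    off s        h _  = refl
subtree-cartAux-beyond (suc f) off []       h _  = refl
subtree-cartAux-beyond (suc f) off (a ∷ xs) h lt with cartAux-split f off a xs
... | rootSplit A v B s≡ _ _ tree≡ = begin
  subtree h (cartAux (suc f) off (a ∷ xs))        ≡⟨ cong (subtree h) tree≡ ⟩
  subtree h (cartNode f off A B)                  ≡⟨ subtree-right (ℕₚ.>⇒≢ root<h) below ⟩
  subtree h (cartAux f (off + suc (length A)) B)  ≡⟨ subtree-cartAux-beyond f _ B h end<h ⟩
  nothing                                         ∎
  where
  open ≡-Reasoning
  end<h : off + suc (length A) + length B < h
  end<h = subst (_< h) (trans (cong (λ s → off + length s) s≡)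
                         (trans (cong (_+_ off) (length-split A v B)) (sym (ℕₚ.+-assoc off _ _))))
                 lt
  root<h : off + suc (length A) < h
  root<h = ℕₚ.≤-<-trans (ℕₚ.m≤m+n _ (length B)) end<h
  below : subtree h (cartAux f off A) ≡ nothing
  below = subtree-cartAux-beyond f off A h (ℕₚ.<-trans (ℕₚ.+-monoʳ-< off (ℕₚ.n<1+n _)) root<h)

subtree-cartAux : ∀ f off s t → length s ≤ f → 1 ≤ t → t ≤ length s →
                  subtree (off + t) (cartAux f off s) hasSN referrers s t
subtree-split : ∀ f off A v B t → All (v ℤ.<_) A → All (v ℤ.≤_) B →
                length A ≤ f → length B ≤ f → 1 ≤ t → t ≤ suc (length A) + length B →
                subtree (off + t) (cartNode f off A B) hasSN referrers (A ++ v ∷ B) t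

subtree-cartAux f       off []       (suc t) _    _   ()
subtree-cartAux (suc f) off (a ∷ xs) t len≤ 1≤t t≤ with cartAux-split f off a xs
... | rootSplit A v B s≡ v<A v≤B tree≡ =
  subst₂ _hasSN_ (cong (subtree (off + t)) (sym tree≡)) (cong (λ s → referrers s t) (sym s≡))
    (subtree-split f off A v B t v<A v≤B lenA≤ lenB≤ 1≤t
      (subst (t ≤_) (trans (cong length s≡) (length-split A v B)) t≤))
  where lenA≤ = proj₁ (parts-fuel s≡ len≤); lenB≤ = proj₂ (parts-fuel s≡ len≤)

subtree-split f off A v B t v<A v≤B lenA≤ lenB≤ 1≤t t≤ with ℕₚ.<-cmp t (suc (length A))
... | tri< t<root _ _ =
  subtree-left (ℕₚ.<⇒≢ (ℕₚ.+-monoʳ-< off t<root))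
    (subst (_ hasSN_) (sym (referrers-++ A (v ∷ B) t (s≤s⁻¹ t<root)))
      (subtree-cartAux f off A t lenA≤ 1≤t (s≤s⁻¹ t<root)))
... | tri≈ _ refl _ =
  subst (_hasSN _)
    (sym (subtree-root (cartAux f off A) (off + suc (length A)) (cartAux f (off + suc (length A)) B)))
    (at-node (trans (rightBranch-cartAux f off A lenA≤) (sym (referrers-at-min v A B v<A))))
... | tri> _ _ root<t with ℕₚ.m≤n⇒∃[o]m+o≡n root<t
...   | u , refl = subst (_hasSN _) (sym pastRoot) (subst₂ _hasSN_ label≡ count≡ inB)
  where
  root = off + suc (length A)
  pastRoot : subtree (off + t) (cartNode f off A B) ≡ subtree (off + t) (cartAux f root B)
  pastRoot = subtree-right (ℕₚ.>⇒≢ (ℕₚ.+-monoʳ-< off root<t))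
               (subtree-cartAux-beyond f off A _
                 (ℕₚ.+-monoʳ-< off (ℕₚ.<-trans (ℕₚ.n<1+n _) root<t)))
  u<B : suc u ≤ length B
  u<B = ℕₚ.+-cancelˡ-≤ (length A) (suc u) (length B)
          (subst (_≤ length A + length B) (sym (ℕₚ.+-suc (length A) u)) (s≤s⁻¹ t≤))
  inB : subtree (root + suc u) (cartAux f root B) hasSN referrers B (suc u)
  inB = subtree-cartAux f root B (suc u) lenB≤ (s≤s z≤n) u<B
  label≡ : subtree (root + suc u) (cartAux f root B) ≡ subtree (off + t) (cartAux f root B)
  label≡ = cong (λ h → subtree h (cartAux f root B))
             (trans (ℕₚ.+-assoc off _ _) (cong (_+_ off) (ℕₚ.+-suc (suc (length A)) u)))
  count≡ : referrers B (suc u) ≡ referrers (A ++ v ∷ B) t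
  count≡ = sym (referrers-after-min v A B u v<A v≤B)

SN≡referrers : ∀ x t → 1 ≤ t → t ≤ length x → SN x t ≡ referrers x t
SN≡referrers x t 1≤t t≤ = SN-hasSN x t (subtree-cartAux (length x) 0 x t ℕₚ.≤-refl 1≤t t≤)

τ-∷ : ∀ a ys k → τ (a ∷ ys) (suc (suc k)) ≡ a ∷ τ ys (suc k)
τ-∷ a []      k = refl
τ-∷ a (b ∷ _) k = refl

τ-involutive : ∀ ys i → τ (τ ys i) i ≡ ys
τ-involutive []           i             = refl
τ-involutive (a ∷ [])     zero          = refl
τ-involutive (a ∷ [])     (suc zero)    = refl
τ-involutive (a ∷ b ∷ ys) zero          = refl
τ-involutive (a ∷ b ∷ ys) (suc zero)    = refl
τ-involutive (a ∷ ys)     (suc (suc i)) =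
  trans (cong (λ zs → τ zs (suc (suc i))) (τ-∷ a ys i))
        (trans (τ-∷ a (τ ys (suc i)) i) (cong (a ∷_) (τ-involutive ys (suc i))))

length-τ : ∀ ys i → length (τ ys i) ≡ length ys
length-τ []           i             = refl
length-τ (a ∷ [])     zero          = refl
length-τ (a ∷ [])     (suc zero)    = refl
length-τ (a ∷ b ∷ ys) zero          = refl
length-τ (a ∷ b ∷ ys) (suc zero)    = refl
length-τ (a ∷ ys)     (suc (suc i)) = trans (cong length (τ-∷ a ys i)) (cong suc (length-τ ys (suc i)))

nextSmaller-∷ : ∀ v b ys {d} → ¬ b ℤ.< v → nextSmaller v ys ≡ just d →
                nextSmaller v (b ∷ ys) ≡ just (suc d)
nextSmaller-∷ v b ys b≮v e with b <? v
... | yes b<v = contradiction b<v b≮v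
... | no _    = cong (Maybe.map suc) e

nextSmaller-∷⁻ : ∀ v b ys {d} → nextSmaller v (b ∷ ys) ≡ just (suc (suc d)) →
                 ¬ b ℤ.< v × nextSmaller v ys ≡ just (suc d)
nextSmaller-∷⁻ v b ys e with b <? v
nextSmaller-∷⁻ v b ys () | yes _
... | no b≮v = b≮v , Maybeₚ.map-injective ℕₚ.suc-injective e

nextSmaller-τ : ∀ v ys k {J} → J ≢ suc k → J ≢ suc (suc k) →
                nextSmaller v (τ ys (suc k)) ≡ just J → nextSmaller v ys ≡ just J
nextSmaller-τ v []           k       _ _ e = e
nextSmaller-τ v (b ∷ [])     zero    _ _ e = e
nextSmaller-τ v (b ∷ [])     (suc k) _ _ e = e
nextSmaller-τ v (b ∷ c ∷ zs) zero {0} _ _ e = contradiction e (nextSmaller-≢0 v (c ∷ b ∷ zs))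
nextSmaller-τ v (b ∷ c ∷ zs) zero {1} J≢ _ _ = contradiction refl J≢
nextSmaller-τ v (b ∷ c ∷ zs) zero {2} _ J≢ _ = contradiction refl J≢
nextSmaller-τ v (b ∷ c ∷ zs) zero {suc (suc (suc J))} _ _ e
  with c≮v , e′ ← nextSmaller-∷⁻ v c (b ∷ zs) e
  with b≮v , e″ ← nextSmaller-∷⁻ v b zs e′ =
  nextSmaller-∷ v b (c ∷ zs) b≮v (nextSmaller-∷ v c zs c≮v e″)
nextSmaller-τ v (b ∷ c ∷ zs) (suc k) {zero} _ _ e =
  contradiction e (nextSmaller-≢0 v (τ (b ∷ c ∷ zs) (suc (suc k))))
nextSmaller-τ v (b ∷ c ∷ zs) (suc k) {suc J} J≢ J≢′ e with b <? v
... | yes _ = e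
... | no _  = cong (Maybe.map suc)
                (nextSmaller-τ v (c ∷ zs) k (J≢ ∘ cong suc) (J≢′ ∘ cong suc)
                  (Maybeₚ.map-injective ℕₚ.suc-injective e))

nextSmaller-τ⁻ : ∀ v ys k {J} → J ≢ suc k → J ≢ suc (suc k) →
                 nextSmaller v ys ≡ just J → nextSmaller v (τ ys (suc k)) ≡ just J
nextSmaller-τ⁻ v ys k J≢ J≢′ e =
  nextSmaller-τ v (τ ys (suc k)) k J≢ J≢′
    (subst (λ zs → nextSmaller v zs ≡ just _) (sym (τ-involutive ys (suc k))) e)

refSearch-suc : ∀ v p ys j → + j ≡ refSearch v p ys → + suc j ≡ refSearch v (suc p) ys
refSearch-suc v p []       j ()
refSearch-suc v p (b ∷ ys) j e with b <? v
... | yes _ = cong (+_ ∘ suc) (ℤₚ.+-injective e)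
... | no _  = refSearch-suc v (suc p) ys j e

ref-∷ : ∀ a ys k j → + j ≡ ref ys (suc k) → + suc j ≡ ref (a ∷ ys) (suc (suc k))
ref-∷ a ys k j e with at ys (suc k)
... | just v = refSearch-suc v (suc (suc k)) (drop (suc k) ys) j e

refSearch-nextSmaller : ∀ v p ys {d} → nextSmaller v ys ≡ just d →
                        refSearch v (suc p) ys ≡ + (p + d)
refSearch-nextSmaller v p [] ()
refSearch-nextSmaller v p (b ∷ ys) e with b <? v
refSearch-nextSmaller v p (b ∷ ys) refl | yes _ = cong +_ (ℕₚ.+-comm 1 p)
... | no _ with nextSmaller v ys | refSearch-nextSmaller v (suc p) ys
refSearch-nextSmaller v p (b ∷ ys) refl | no _ | just d | ih =
  trans (ih refl) (cong +_ (sym (ℕₚ.+-suc p d)))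

indicator-¬ref : ∀ v p ys d → + (p + d) ≢ refSearch v (suc p) ys →
                 indicator (nextSmaller v ys ≟ just d) ≡ 0
indicator-¬ref v p ys d r = indicator-no (r ∘ sym ∘ refSearch-nextSmaller v p ys) _

referrers-τ : ∀ x i j → 1 ≤ i → j ≢ i → j ≢ suc i →
              + j ≢ ref x i → + j ≢ ref x (suc i) →
              + j ≢ ref (τ x i) i → + j ≢ ref (τ x i) (suc i) →
              referrers (τ x i) j ≡ referrers x j
referrers-τ []           (suc i)       j    _ _ _     _ _ _ _ = refl
referrers-τ (a ∷ [])     (suc zero)    j    _ _ _     _ _ _ _ = refl
referrers-τ (a ∷ [])     (suc (suc i)) j    _ _ _     _ _ _ _ = refl
referrers-τ (a ∷ b ∷ xs) (suc i)       zero _ _ _     _ _ _ _ = referrers-zero (τ (a ∷ b ∷ xs) (suc i))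
referrers-τ (a ∷ b ∷ xs) 1             1    _ j≢i _   _ _ _ _ = contradiction refl j≢i
referrers-τ (a ∷ b ∷ xs) 1             2    _ _ j≢i+1 _ _ _ _ = contradiction refl j≢i+1
referrers-τ (a ∷ b ∷ xs) 1 (suc (suc (suc J))) _ _ _ r₁ r₂ r₃ r₄
  rewrite indicator-¬ref b 1 (a ∷ xs) (suc (suc J)) r₃ | indicator-¬ref a 2 xs (suc J) r₄
        | indicator-¬ref a 1 (b ∷ xs) (suc (suc J)) r₁ | indicator-¬ref b 2 xs (suc J) r₂ = refl
referrers-τ (a ∷ xs@(b ∷ _)) (suc (suc k)) (suc J) _ j≢i j≢i+1 r₁ r₂ r₃ r₄ =
  cong₂ _+_ (indicator-cong (nextSmaller-τ a xs k J≢ J≢′) (nextSmaller-τ⁻ a xs k J≢ J≢′) _ _)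
    (referrers-τ xs (suc k) J (s≤s z≤n) J≢ J≢′
      (r₁ ∘ ref-∷ a xs k J) (r₂ ∘ ref-∷ a xs (suc k) J)
      (r₃ ∘ ref-∷ a (τ xs (suc k)) k J) (r₄ ∘ ref-∷ a (τ xs (suc k)) (suc k) J))
  where
  J≢ = j≢i ∘ cong suc
  J≢′ = j≢i+1 ∘ cong suc

lemma16 : (x : List ℤ) → AllPairs _≢_ x →
          (i : ℕ) → 1 ≤ i → i < length x →
          (j : ℕ) → 1 ≤ j → j ≤ length x →
          j ≢ i → j ≢ suc i →
          + j ≢ ref x i → + j ≢ ref x (suc i) →
          + j ≢ ref (τ x i) i → + j ≢ ref (τ x i) (suc i) →
          SN (τ x i) j ≡ SN x j
lemma16 x _ i 1≤i _ j 1≤j j≤ j≢i j≢i+1 r₁ r₂ r₃ r₄ = begin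
  SN (τ x i) j         ≡⟨ SN≡referrers (τ x i) j 1≤j (subst (j ≤_) (sym (length-τ x i)) j≤) ⟩
  referrers (τ x i) j  ≡⟨ referrers-τ x i j 1≤i j≢i j≢i+1 r₁ r₂ r₃ r₄ ⟩
  referrers x j        ≡⟨ SN≡referrers x j 1≤j j≤ ⟨
  SN x j               ∎
  where open ≡-Reasoning
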